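{- With $v_1,v_2,v_3$ as in the context, for every $n\ge 0$, $$v_1(n)-2v_2(n)+v_3(n)\in\{0,-1,-2\}.$$
   Context: $\mathbb{N}_0$ denotes the non-negative integers. For $F\subset\mathbb{N}_0$ let $\mathrm{Mex}(F)=\min(\mathbb{N}_0\setminus F)$, and $a+D=\{a+d:d\in D\}$. Define recursively: $G_0=\{(0,0,0)\}$, $v_1(0)=v_2(0)=v_3(0)=0$; for $n\ge 0$, let $F_n$ be the set of all coordinates of all triples in $G_n$, $D_n=\bigcup_{x\in G_n}\{x_2-x_1,x_3-x_2,x_3-x_1\}$, and $v_1(n+1)=\mathrm{Mex}(F_n)$, $v_2(n+1)=\mathrm{Mex}\big((v_1(n+1)+D_n)\cup\{1,\dots,v_1(n+1)\}\cup F_n\big)$, $v_3(n+1)=\mathrm{Mex}\big((v_2(n+1)+D_n)\cup\{1,\dots,v_2(n+1)\}\cup F_n\big)$, $G_{n+1}=G_n\cup\{(v_1(n+1),v_2(n+1),v_3(n+1))\}$. -}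

module Defs where

open import Data.Nat using (ℕ; zero; suc)
open import Data.Integer as ℤ using (ℤ; +_; _-_)
open import Data.Product using (_×_; _,_; proj₁; proj₂)
open import Data.List using (List; []; _∷_; _++_; map; concatMap; length; upTo)
open import Data.List.Membership.DecPropositional ℤ._≟_ using (_∈?_)
open import Relation.Nullary using (yes; no)

Triple : Set
Triple = ℕ × ℕ × ℕ

fst snd thd : Triple → ℕ
fst (a , _ , _) = a
snd (_ , b , _) = b
thd (_ , _ , c) = c

-- Finite sets of integers are represented as lists (membership = list membership).
-- The search starts at 0 with fuel length L + 1; since at most length L
-- naturals can belong to L, some m ≤ length L is not in L, so the search
-- always stops at the true minimum before fuel runs out.
mexFrom : ℕ → ℕ → List ℤ → ℕ
mexFrom zero    k L = k
mexFrom (suc f) k L with (+ k) ∈? L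
... | yes _ = mexFrom f (suc k) L
... | no  _ = k

Mex : List ℤ → ℕ
Mex L = mexFrom (suc (length L)) 0 L

coords : List Triple → List ℤ
coords = concatMap (λ x → + fst x ∷ + snd x ∷ + thd x ∷ [])

diffs : List Triple → List ℤ
diffs = concatMap (λ x → (+ snd x - + fst x) ∷ (+ thd x - + snd x) ∷ (+ thd x - + fst x) ∷ [])

shift : ℕ → List ℤ → List ℤ
shift a = map (λ d → + a ℤ.+ d)

oneTo : ℕ → List ℤ
oneTo a = map (λ i → + suc i) (upTo a)

newTriple : List Triple → Triple
newTriple G =
  let F  = coords G
      D  = diffs G
      w₁ = Mex F
      w₂ = Mex (shift w₁ D ++ oneTo w₁ ++ F)
      w₃ = Mex (shift w₂ D ++ oneTo w₂ ++ F)
  in w₁ , w₂ , w₃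

G : ℕ → List Triple
v : ℕ → Triple
G zero    = (0 , 0 , 0) ∷ []
G (suc n) = G n ++ (v (suc n) ∷ [])
v zero    = 0 , 0 , 0
v (suc n) = newTriple (G n)

v₁ v₂ v₃ : ℕ → ℕ
v₁ n = fst (v n)
v₂ n = snd (v n)
v₃ n = thd (v n)

{-# OPTIONS --safe #-}
-- Let M n be the least difference missing after step n − 1 (M 0 = 0) and
-- δ n = v₂ n − v₁ n − M n.  By strong induction every triple has the shape
--   v₂ n = v₁ n + M n + δ n,   v₃ n = v₂ n + M n,   δ n ≤ 2,
-- and after step n all of 0 … M n + δ n occur as differences, so M (n + 1) > M n + δ n.
-- For the step, put a = v₁ (n + 1) and m = M (n + 1).  Every candidate below a + m for v₂
-- is excluded (by 0, by 1 … a, or as a + d with d < m a difference), while a + m + t is free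
-- as soon as m + t is no difference and a + m + t no coordinate.  Coordinates ≥ a + m are
-- third coordinates, which grow by at least 3 from one triple to the next; differences > m
-- are of the form v₃ − v₁, which grow by at least 2.  Hence one of t = 0, 1, 2 is free and
-- δ (n + 1) ≤ 2.  Next v₃ = v₂ + m, because m is no difference and all coordinates lie below
-- a + 2m.  Finally v₁ − 2 v₂ + v₃ = − δ n.
module Submission where

open import Defs

-- The natural-number operators are opened only inside this block, so that the statement
-- of corollary5 below can use the integer operators unqualified.
module _ where

  import Algebra.Properties.AbelianGroup
  open import Data.Fin using (Fin; toℕ)
  open import Data.Fin.Properties using (pigeonhole; toℕ<n)
  open import Data.Integer as ℤ using (ℤ; +_; -[1+_])
  open import Data.Integer.Properties as ℤ using (+-0-abelianGroup; m-n≡m⊖n; ⊖-≥; pos-+)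
  open import Data.Integer.Tactic.RingSolver using (solve-∀)
  open import Data.List using (List; []; _∷_; _++_; length; lookup; applyUpTo; concatMap)
  open import Data.List.Properties using (applyUpTo-∷ʳ)
  open import Data.List.Membership.Propositional using (_∈_; _∉_; find; lose)
  open import Data.List.Membership.Propositional.Properties
    using ( ∈-++⁺ˡ; ∈-++⁺ʳ; ∈-++⁻; ∈-map⁺; ∈-map⁻; ∈-upTo⁺; ∈-upTo⁻
          ; ∈-applyUpTo⁺; ∈-applyUpTo⁻; ∈-concatMap⁺; ∈-concatMap⁻)
  open import Data.List.Membership.DecPropositional ℤ._≟_ using (_∈?_)
  open import Data.List.Relation.Binary.Subset.Propositional using (_⊆_)
  open import Data.List.Relation.Unary.Any using (here; there; index)
  open import Data.List.Relation.Unary.Any.Properties using (lookup-index)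
  open import Data.Nat
    using (ℕ; zero; suc; _+_; _∸_; _≤_; _<_; _≤?_; _<?_; z≤n; s≤s; s≤s⁻¹; z<s)
  open import Data.Nat.Induction using (<-rec)
  open import Data.Nat.Properties
  open import Data.Product using (_×_; _,_; ∃)
  open import Data.Sum using (_⊎_; inj₁; inj₂; [_,_]; fromInj₂)
  open import Relation.Binary.Definitions using (tri<; tri≈; tri>)
  open import Relation.Binary.PropositionalEquality
    using (_≡_; refl; sym; trans; cong; cong₂; subst; subst₂; module ≡-Reasoning)
  open import Relation.Nullary using (yes; no; contradiction)

  open Algebra.Properties.AbelianGroup +-0-abelianGroup using (∙-cancelˡ)

  mexFrom-∈ : ∀ f k (L : List ℤ) → + mexFrom f k L ∈ L → mexFrom f k L ≡ f + k
  mexFrom-∈ zero    k L _ = refl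
  mexFrom-∈ (suc f) k L p with + k ∈? L
  ... | yes _   = trans (mexFrom-∈ f (suc k) L p) (+-suc f k)
  ... | no k∉L = contradiction p k∉L

  mexFrom-covers : ∀ f k (L : List ℤ) → (∀ {y} → y < k → + y ∈ L) →
                   ∀ {y} → y < mexFrom f k L → + y ∈ L
  mexFrom-covers zero    k L below-k = below-k
  mexFrom-covers (suc f) k L below-k with + k ∈? L
  ... | yes k∈L = mexFrom-covers f (suc k) L below-1+k
    where
    below-1+k : ∀ {y} → y < suc k → + y ∈ L
    below-1+k y<1+k with m<1+n⇒m<n∨m≡n y<1+k
    ... | inj₁ y<k  = below-k y<k
    ... | inj₂ refl = k∈L
  ... | no _ = below-k

  covered⇒≤length : ∀ x (L : List ℤ) → (∀ {y} → y < x → + y ∈ L) → x ≤ length L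
  covered⇒≤length x L covers = ≮⇒≥ λ length<x →
    let i , j , i<j , same-position = pigeonhole length<x (λ i → index (position i))
    in <-irrefl (ℤ.+-injective (trans (lookup-index (position i))
                 (trans (cong (lookup L) same-position) (sym (lookup-index (position j)))))) i<j
    where
    position : (i : Fin x) → + toℕ i ∈ L
    position i = covers (toℕ<n i)

  Mex-covers : ∀ L {y} → y < Mex L → + y ∈ L
  Mex-covers L = mexFrom-covers (suc (length L)) 0 L λ ()

  -- By pigeonhole the search never exhausts its fuel length L + 1.
  Mex-∉ : ∀ L → + Mex L ∉ L
  Mex-∉ L Mex∈L =
    1+n≰n (subst (_≤ length L) fuel-exhausted (covered⇒≤length (Mex L) L (Mex-covers L)))
    where
    fuel-exhausted : Mex L ≡ suc (length L)
    fuel-exhausted = trans (mexFrom-∈ (suc (length L)) 0 L Mex∈L) (+-identityʳ _)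

  Mex-≤ : ∀ L {x} → + x ∉ L → Mex L ≤ x
  Mex-≤ L x∉L = ≮⇒≥ λ x<Mex → x∉L (Mex-covers L x<Mex)

  Mex-≥ : ∀ L {x} → (∀ {y} → y < x → + y ∈ L) → x ≤ Mex L
  Mex-≥ L covers = ≮⇒≥ λ Mex<x → Mex-∉ L (covers Mex<x)

  +[m+n]-+m : ∀ m n → + (m + n) ℤ.- + m ≡ + n
  +[m+n]-+m m n = begin
    + (m + n) ℤ.- + m  ≡⟨ m-n≡m⊖n (m + n) m ⟩
    (m + n) ℤ.⊖ m      ≡⟨ ⊖-≥ (m≤m+n m n) ⟩
    + (m + n ∸ m)      ≡⟨ cong +_ (m+n∸m≡n m n) ⟩
    + n                ∎
    where open ≡-Reasoning

  gap-separated : ∀ (g : ℕ → ℕ) {gap n} → (∀ {j j′} → j < j′ → j′ ≤ n → gap + g j ≤ g j′) →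
                  ∀ {j j′ s} → j ≤ n → j′ ≤ n → 0 < s → g j′ ≡ g j + s → gap ≤ s
  gap-separated g {gap} growth {j} {j′} {s} j≤n j′≤n 0<s gj′≡gj+s =
    +-cancelˡ-≤ (g j) gap s (begin
      g j + gap  ≡⟨ +-comm (g j) gap ⟩
      gap + g j  ≤⟨ gap+gj≤gj′ ⟩
      g j′       ≡⟨ gj′≡gj+s ⟩
      g j + s    ∎)
    where
    open ≤-Reasoning
    gj<gj′ : g j < g j′
    gj<gj′ = subst (g j <_) (sym gj′≡gj+s) (m<m+n (g j) 0<s)
    gap+gj≤gj′ : gap + g j ≤ g j′
    gap+gj≤gj′ with <-cmp j j′
    ... | tri< j<j′ _ _ = growth j<j′ j′≤n
    ... | tri≈ _ refl _ = contradiction gj<gj′ (<-irrefl refl)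
    ... | tri> _ _ j′<j = contradiction (≤-trans (m≤n+m _ gap) (growth j′<j j≤n)) (<⇒≱ gj<gj′)

  x+d<y⇒2+[x+d+x]≤y+e+y : ∀ {x d y} e → x + d < y → 2 + (x + d + x) ≤ y + e + y
  x+d<y⇒2+[x+d+x]≤y+e+y {x} {d} {y} e x+d<y = begin
    2 + (x + d + x)      ≡⟨ +-suc (suc (x + d)) x ⟨
    suc (x + d) + suc x  ≤⟨ +-mono-≤ x+d<y (≤-<-trans (m≤m+n x d) x+d<y) ⟩
    y + y                ≤⟨ +-monoˡ-≤ y (m≤m+n y e) ⟩
    y + e + y            ∎
    where open ≤-Reasoning

  x<y⇒3+[x+s]≤y+t : ∀ {x y s t} → x < y → 2 + s ≤ t → 3 + (x + s) ≤ y + t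
  x<y⇒3+[x+s]≤y+t {x} {y} {s} {t} x<y 2+s≤t = begin
    3 + (x + s)        ≡⟨ cong suc (trans (+-suc x (suc s)) (cong suc (+-suc x s))) ⟨
    suc x + (2 + s)    ≤⟨ +-mono-≤ x<y 2+s≤t ⟩
    y + t              ∎
    where open ≤-Reasoning

  neg-≤2 : ∀ {d} → d ≤ 2 →
           (ℤ.- + d ≡ + 0) ⊎ (ℤ.- + d ≡ -[1+ 0 ]) ⊎ (ℤ.- + d ≡ -[1+ 1 ])
  neg-≤2 {0} _ = inj₁ refl
  neg-≤2 {1} _ = inj₂ (inj₁ refl)
  neg-≤2 {2} _ = inj₂ (inj₂ refl)
  neg-≤2 {suc (suc (suc _))} (s≤s (s≤s ()))

  x-2[x+μ+d]+[x+μ+d+μ]≡-d : ∀ (x μ d : ℤ) →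
    x ℤ.- + 2 ℤ.* (x ℤ.+ (μ ℤ.+ d)) ℤ.+ (x ℤ.+ (μ ℤ.+ d) ℤ.+ μ) ≡ ℤ.- d
  x-2[x+μ+d]+[x+μ+d+μ]≡-d = solve-∀

  ∈-shift⁺ : ∀ w {D x} → + x ∈ D → + (w + x) ∈ shift w D
  ∈-shift⁺ w {D} {x} x∈D =
    subst (_∈ shift w D) (sym (pos-+ w x)) (∈-map⁺ (λ d → + w ℤ.+ d) x∈D)

  ∈-shift⁻ : ∀ w {D x} → + (w + x) ∈ shift w D → + x ∈ D
  ∈-shift⁻ w {D} {x} p with ∈-map⁻ (λ d → + w ℤ.+ d) p
  ... | d , d∈D , eq = subst (_∈ D) (∙-cancelˡ (+ w) d (+ x) (trans (sym eq) (pos-+ w x))) d∈D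

  ∈-oneTo⁺ : ∀ {w y} → suc y ≤ w → + suc y ∈ oneTo w
  ∈-oneTo⁺ y<w = ∈-map⁺ (λ i → + suc i) (∈-upTo⁺ y<w)

  ∈-oneTo⁻ : ∀ {w y} → + y ∈ oneTo w → y ≤ w
  ∈-oneTo⁻ p with ∈-map⁻ (λ i → + suc i) p
  ... | i , i∈upTo , refl = ∈-upTo⁻ i∈upTo

  -- newTriple chooses v₂ = Mex (excluded v₁ D F) and v₃ = Mex (excluded v₂ D F).
  excluded : ℕ → List ℤ → List ℤ → List ℤ
  excluded w D F = shift w D ++ oneTo w ++ F

  excluded-covers : ∀ w {D F y} → + 0 ∈ F → y < w + Mex D → + y ∈ excluded w D F
  excluded-covers w {D} {F} {zero} 0∈F _ = ∈-++⁺ʳ (shift w D) (∈-++⁺ʳ (oneTo w) 0∈F)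
  excluded-covers w {D} {F} {suc y} _ 1+y<w+Mex with suc y ≤? w
  ... | yes 1+y≤w = ∈-++⁺ʳ (shift w D) (∈-++⁺ˡ (∈-oneTo⁺ 1+y≤w))
  ... | no 1+y≰w =
    ∈-++⁺ˡ (subst (λ z → + z ∈ shift w D) w+offset≡ (∈-shift⁺ w (Mex-covers D offset<Mex)))
    where
    w+offset≡ : w + (suc y ∸ w) ≡ suc y
    w+offset≡ = m+[n∸m]≡n (<⇒≤ (≰⇒> 1+y≰w))
    offset<Mex : suc y ∸ w < Mex D
    offset<Mex = +-cancelˡ-< w _ _ (subst (_< w + Mex D) (sym w+offset≡) 1+y<w+Mex)

  excluded⁻ : ∀ w {D F x} → 0 < x → + (w + x) ∈ excluded w D F → + x ∈ D ⊎ + (w + x) ∈ F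
  excluded⁻ w {D} 0<x p with ∈-++⁻ (shift w D) p
  ... | inj₁ p∈shift = inj₁ (∈-shift⁻ w p∈shift)
  ... | inj₂ p′ with ∈-++⁻ (oneTo w) p′
  ...   | inj₁ p∈oneTo = contradiction (∈-oneTo⁻ p∈oneTo) (<⇒≱ (m<m+n w 0<x))
  ...   | inj₂ p∈F     = inj₂ p∈F

  Mex-excluded-≥ : ∀ w {D F} → + 0 ∈ F → w + Mex D ≤ Mex (excluded w D F)
  Mex-excluded-≥ w {D} {F} 0∈F = Mex-≥ (excluded w D F) (excluded-covers w {D} 0∈F)

  Mex-excluded-≤ : ∀ w {D F x} → 0 < x → + x ∉ D → + (w + x) ∉ F →
                   Mex (excluded w D F) ≤ w + x
  Mex-excluded-≤ w {D} {F} 0<x x∉D w+x∉F =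
    Mex-≤ (excluded w D F) λ p → [ x∉D , w+x∉F ] (excluded⁻ w 0<x p)

  G≡applyUpTo : ∀ n → G n ≡ applyUpTo v (suc n)
  G≡applyUpTo zero    = refl
  G≡applyUpTo (suc n) = trans (cong (_++ v (suc n) ∷ []) (G≡applyUpTo n)) (applyUpTo-∷ʳ v (suc n))

  ∈G⁻ : ∀ {n x} → x ∈ G n → ∃ λ k → k ≤ n × x ≡ v k
  ∈G⁻ {n} {x} p with ∈-applyUpTo⁻ v (subst (x ∈_) (G≡applyUpTo n) p)
  ... | k , k<1+n , eq = k , s≤s⁻¹ k<1+n , eq

  ∈G⁺ : ∀ {n k} → k ≤ n → v k ∈ G n
  ∈G⁺ {n} {k} k≤n = subst (v k ∈_) (sym (G≡applyUpTo n)) (∈-applyUpTo⁺ v (s≤s k≤n))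

  module _ (h : Triple → List ℤ) where

    ∈-concatMap-G⁻ : ∀ {n y} → y ∈ concatMap h (G n) → ∃ λ k → k ≤ n × y ∈ h (v k)
    ∈-concatMap-G⁻ p with find (∈-concatMap⁻ h p)
    ... | x , x∈G , y∈hx with ∈G⁻ x∈G
    ...   | k , k≤n , refl = k , k≤n , y∈hx

    ∈-concatMap-G⁺ : ∀ {n k y} → k ≤ n → y ∈ h (v k) → y ∈ concatMap h (G n)
    ∈-concatMap-G⁺ k≤n y∈hv = ∈-concatMap⁺ h (lose (∈G⁺ k≤n) y∈hv)

    concatMap-G-mono : ∀ {j n} → j ≤ n → concatMap h (G j) ⊆ concatMap h (G n)
    concatMap-G-mono j≤n p with ∈-concatMap-G⁻ p
    ... | k , k≤j , y∈hv = ∈-concatMap-G⁺ (≤-trans k≤j j≤n) y∈hv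

  ∈-triple⁻ : ∀ {A : Set} {y a b c : A} → y ∈ a ∷ b ∷ c ∷ [] → y ≡ a ⊎ y ≡ b ⊎ y ≡ c
  ∈-triple⁻ (here eq)                 = inj₁ eq
  ∈-triple⁻ (there (here eq))         = inj₂ (inj₁ eq)
  ∈-triple⁻ (there (there (here eq))) = inj₂ (inj₂ eq)

  ∈coords⁻ : ∀ {n y} → y ∈ coords (G n) →
             ∃ λ k → k ≤ n × (y ≡ + v₁ k ⊎ y ≡ + v₂ k ⊎ y ≡ + v₃ k)
  ∈coords⁻ p with ∈-concatMap-G⁻ _ p
  ... | k , k≤n , y∈ = k , k≤n , ∈-triple⁻ y∈

  ∈diffs⁻ : ∀ {n y} → y ∈ diffs (G n) →
            ∃ λ k → k ≤ n ×
              (y ≡ + v₂ k ℤ.- + v₁ k ⊎ y ≡ + v₃ k ℤ.- + v₂ k ⊎ y ≡ + v₃ k ℤ.- + v₁ k)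
  ∈diffs⁻ p with ∈-concatMap-G⁻ _ p
  ... | k , k≤n , y∈ = k , k≤n , ∈-triple⁻ y∈

  v₁∈coords : ∀ {n k} → k ≤ n → + v₁ k ∈ coords (G n)
  v₁∈coords k≤n = ∈-concatMap-G⁺ _ k≤n (here refl)

  v₂-v₁∈diffs : ∀ {n k} → k ≤ n → + v₂ k ℤ.- + v₁ k ∈ diffs (G n)
  v₂-v₁∈diffs k≤n = ∈-concatMap-G⁺ _ k≤n (here refl)

  v₃-v₂∈diffs : ∀ {n k} → k ≤ n → + v₃ k ℤ.- + v₂ k ∈ diffs (G n)
  v₃-v₂∈diffs k≤n = ∈-concatMap-G⁺ _ k≤n (there (here refl))

  coords-mono : ∀ {j n} → j ≤ n → coords (G j) ⊆ coords (G n)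
  coords-mono = concatMap-G-mono _

  diffs-mono : ∀ {j n} → j ≤ n → diffs (G j) ⊆ diffs (G n)
  diffs-mono = concatMap-G-mono _

  v₁-covers : ∀ n {y} → y ≤ v₁ n → + y ∈ coords (G n)
  v₁-covers zero    z≤n = here refl
  v₁-covers (suc n) y≤v₁ with m≤n⇒m<n∨m≡n y≤v₁
  ... | inj₁ y<v₁ = coords-mono (n≤1+n n) (Mex-covers (coords (G n)) y<v₁)
  ... | inj₂ refl = v₁∈coords {suc n} ≤-refl

  v₁-increasing : ∀ {j k} → j < k → v₁ j < v₁ k
  v₁-increasing {j} {suc k} (s≤s j≤k) =
    Mex-≥ (coords (G k)) λ y<1+v₁ → coords-mono j≤k (v₁-covers j (s≤s⁻¹ y<1+v₁))

  M : ℕ → ℕ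
  M zero    = 0
  M (suc n) = Mex (diffs (G n))

  M-above : ∀ {j k x} → (∀ {y} → y ≤ x → + y ∈ diffs (G j)) → j < k → x < M k
  M-above {k = suc k} covers (s≤s j≤k) =
    Mex-≥ (diffs (G k)) λ y<1+x → diffs-mono j≤k (covers (s≤s⁻¹ y<1+x))

  δ : ℕ → ℕ
  δ n = v₂ n ∸ (v₁ n + M n)

  span : ℕ → ℕ
  span n = M n + δ n + M n

  record Shape (n : ℕ) : Set where
    field
      δ≤2          : δ n ≤ 2
      v₂≡          : v₂ n ≡ v₁ n + (M n + δ n)
      v₃≡          : v₃ n ≡ v₂ n + M n
      diffs-covers : ∀ {y} → y ≤ M n + δ n → + y ∈ diffs (G n)

    v₃≡v₁+span : v₃ n ≡ v₁ n + span n
    v₃≡v₁+span = trans v₃≡ (trans (cong (_+ M n) v₂≡) (+-assoc (v₁ n) (M n + δ n) (M n)))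

    v₂-v₁≡ : + v₂ n ℤ.- + v₁ n ≡ + (M n + δ n)
    v₂-v₁≡ = trans (cong (λ z → + z ℤ.- + v₁ n) v₂≡) (+[m+n]-+m (v₁ n) (M n + δ n))

    v₃-v₂≡ : + v₃ n ℤ.- + v₂ n ≡ + M n
    v₃-v₂≡ = trans (cong (λ z → + z ℤ.- + v₂ n) v₃≡) (+[m+n]-+m (v₂ n) (M n))

    v₃-v₁≡ : + v₃ n ℤ.- + v₁ n ≡ + span n
    v₃-v₁≡ = trans (cong (λ z → + z ℤ.- + v₁ n) v₃≡v₁+span) (+[m+n]-+m (v₁ n) (span n))

  open Shape

  shape-zero : Shape 0
  shape-zero = record
    { δ≤2 = z≤n ; v₂≡ = refl ; v₃≡ = refl ; diffs-covers = λ { z≤n → here refl } }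

  module Step (n : ℕ) (shape≤ : ∀ {k} → k ≤ n → Shape k) where

    F D D′ : List ℤ
    F  = coords (G n)
    D  = diffs (G n)
    D′ = diffs (G (suc n))

    a m b : ℕ
    a = v₁ (suc n)
    m = M (suc n)
    b = v₂ (suc n)

    0∈F : + 0 ∈ F
    0∈F = v₁∈coords {n} z≤n

    0<m : 0 < m
    0<m = Mex-≥ D λ { (s≤s z≤n) → v₂-v₁∈diffs {n} z≤n }

    m∉D : + m ∉ D
    m∉D = Mex-∉ D

    M+δ<m : ∀ {j} → j ≤ n → M j + δ j < m
    M+δ<m j≤n = M-above (diffs-covers (shape≤ j≤n)) (s≤s j≤n)

    M<m : ∀ {j} → j ≤ n → M j < m
    M<m j≤n = ≤-<-trans (m≤m+n _ _) (M+δ<m j≤n)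

    v₁<a : ∀ {j} → j ≤ n → v₁ j < a
    v₁<a j≤n = v₁-increasing (s≤s j≤n)

    v₂<a+m : ∀ {j} → j ≤ n → v₂ j < a + m
    v₂<a+m j≤n = subst (_< a + m) (sym (v₂≡ (shape≤ j≤n))) (+-mono-< (v₁<a j≤n) (M+δ<m j≤n))

    v₃<a+m+m : ∀ {j} → j ≤ n → v₃ j < a + m + m
    v₃<a+m+m j≤n =
      subst (_< a + m + m) (sym (v₃≡ (shape≤ j≤n))) (+-mono-< (v₂<a+m j≤n) (M<m j≤n))

    F-bounded : ∀ {y} → + y ∈ F → y < a + m + m
    F-bounded p with ∈coords⁻ p
    ... | j , j≤n , inj₁ refl        = <-≤-trans (v₁<a j≤n) (≤-trans (m≤m+n a m) (m≤m+n (a + m) m))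
    ... | j , j≤n , inj₂ (inj₁ refl) = <-≤-trans (v₂<a+m j≤n) (m≤m+n (a + m) m)
    ... | j , j≤n , inj₂ (inj₂ refl) = v₃<a+m+m j≤n

    F-high : ∀ {y} → + y ∈ F → a + m ≤ y → ∃ λ j → j ≤ n × y ≡ v₃ j
    F-high p a+m≤y with ∈coords⁻ p
    ... | j , j≤n , inj₁ refl        = contradiction (<-≤-trans (v₁<a j≤n) (m≤m+n a m)) (≤⇒≯ a+m≤y)
    ... | j , j≤n , inj₂ (inj₁ refl) = contradiction (v₂<a+m j≤n) (≤⇒≯ a+m≤y)
    ... | j , j≤n , inj₂ (inj₂ refl) = j , j≤n , refl

    ∈D⁻ : ∀ {y} → + y ∈ D → ∃ λ j → j ≤ n × (y ≡ M j + δ j ⊎ y ≡ M j ⊎ y ≡ span j)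
    ∈D⁻ p with ∈diffs⁻ p
    ... | j , j≤n , inj₁ eq        = j , j≤n , inj₁ (ℤ.+-injective (trans eq (v₂-v₁≡ (shape≤ j≤n))))
    ... | j , j≤n , inj₂ (inj₁ eq) =
      j , j≤n , inj₂ (inj₁ (ℤ.+-injective (trans eq (v₃-v₂≡ (shape≤ j≤n)))))
    ... | j , j≤n , inj₂ (inj₂ eq) =
      j , j≤n , inj₂ (inj₂ (ℤ.+-injective (trans eq (v₃-v₁≡ (shape≤ j≤n)))))

    D-high : ∀ {y} → + y ∈ D → m < y → ∃ λ j → j ≤ n × y ≡ span j
    D-high p m<y with ∈D⁻ p
    ... | j , j≤n , inj₁ refl        = contradiction (M+δ<m j≤n) (<-asym m<y)
    ... | j , j≤n , inj₂ (inj₁ refl) = contradiction (M<m j≤n) (<-asym m<y)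
    ... | j , j≤n , inj₂ (inj₂ refl) = j , j≤n , refl

    span-growth : ∀ {j j′} → j < j′ → j′ ≤ n → 2 + span j ≤ span j′
    span-growth {j} {j′} j<j′ j′≤n =
      x+d<y⇒2+[x+d+x]≤y+e+y {M j} {δ j} (δ j′) (M-above (diffs-covers (shape≤ j≤n)) j<j′)
      where
      j≤n : j ≤ n
      j≤n = ≤-trans (<⇒≤ j<j′) j′≤n

    v₃-growth : ∀ {j j′} → j < j′ → j′ ≤ n → 3 + v₃ j ≤ v₃ j′
    v₃-growth {j} {j′} j<j′ j′≤n =
      subst₂ (λ p q → 3 + p ≤ q) (sym (v₃≡v₁+span (shape≤ j≤n))) (sym (v₃≡v₁+span (shape≤ j′≤n)))
        (x<y⇒3+[x+s]≤y+t (v₁-increasing j<j′) (span-growth j<j′ j′≤n))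
      where
      j≤n : j ≤ n
      j≤n = ≤-trans (<⇒≤ j<j′) j′≤n

    F-sparse : ∀ {x s} → a + m ≤ x → + x ∈ F → + (x + s) ∈ F → 0 < s → 3 ≤ s
    F-sparse {x} {s} a+m≤x x∈F x+s∈F 0<s
      with F-high x∈F a+m≤x | F-high x+s∈F (≤-trans a+m≤x (m≤m+n x s))
    ... | j , j≤n , x≡ | j′ , j′≤n , x+s≡ =
      gap-separated v₃ v₃-growth j≤n j′≤n 0<s (trans (sym x+s≡) (cong (_+ s) x≡))

    D-sparse : ∀ {x s} → m < x → + x ∈ D → + (x + s) ∈ D → 0 < s → 2 ≤ s
    D-sparse {x} {s} m<x x∈D x+s∈D 0<s
      with D-high x∈D m<x | D-high x+s∈D (<-≤-trans m<x (m≤m+n x s))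
    ... | j , j≤n , x≡ | j′ , j′≤n , x+s≡ =
      gap-separated span span-growth j≤n j′≤n 0<s (trans (sym x+s≡) (cong (_+ s) x≡))

    a+m≤b : a + m ≤ b
    a+m≤b = Mex-excluded-≥ a {D} 0∈F

    below-b : ∀ {x} → 0 < x → a + x < b → + x ∈ D ⊎ + (a + x) ∈ F
    below-b 0<x a+x<b = excluded⁻ a 0<x (Mex-covers (excluded a D F) a+x<b)

    a+m∈F : a + m < b → + (a + m) ∈ F
    a+m∈F a+m<b = fromInj₂ (λ m∈D → contradiction m∈D m∉D) (below-b 0<m a+m<b)

    m+t∈D : ∀ {t} → 0 < t → t ≤ 2 → a + (m + t) < b → + (m + t) ∈ D
    m+t∈D {t} 0<t t≤2 a+[m+t]<b with below-b (<-≤-trans 0<m (m≤m+n m t)) a+[m+t]<b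
    ... | inj₁ m+t∈D′ = m+t∈D′
    ... | inj₂ a+[m+t]∈F = contradiction t≤2 (<⇒≱ (F-sparse ≤-refl (a+m∈F a+m<b) a+m+t∈F 0<t))
      where
      a+m<b : a + m < b
      a+m<b = <-trans (+-monoʳ-< a (m<m+n m 0<t)) a+[m+t]<b
      a+m+t∈F : + (a + m + t) ∈ F
      a+m+t∈F = subst (λ z → + z ∈ F) (sym (+-assoc a m t)) a+[m+t]∈F

    b≤a+[m+2] : b ≤ a + (m + 2)
    b≤a+[m+2] = ≮⇒≥ λ a+[m+2]<b →
      let a+[m+1]<b = ≤-<-trans (+-monoʳ-≤ a (+-monoʳ-≤ m (n≤1+n 1))) a+[m+2]<b
          m+1∈D     = m+t∈D z<s (s≤s z≤n) a+[m+1]<b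
          m+1+1∈D   = subst (λ z → + z ∈ D) (sym (+-assoc m 1 1)) (m+t∈D z<s ≤-refl a+[m+2]<b)
      in 1+n≰n (D-sparse (m<m+n m z<s) m+1∈D m+1+1∈D z<s)

    δ≤2′ : δ (suc n) ≤ 2
    δ≤2′ = m≤n+o⇒m∸n≤o b (a + m) (subst (b ≤_) (sym (+-assoc a m 2)) b≤a+[m+2])

    b≡ : b ≡ a + (m + δ (suc n))
    b≡ = trans (sym (m+[n∸m]≡n a+m≤b)) (+-assoc a m (δ (suc n)))

    c≡b+m : v₃ (suc n) ≡ b + m
    c≡b+m = ≤-antisym (Mex-excluded-≤ b 0<m m∉D b+m∉F) (Mex-excluded-≥ b {D} 0∈F)
      where
      b+m∉F : + (b + m) ∉ F
      b+m∉F p = <⇒≱ (F-bounded p) (+-monoˡ-≤ m a+m≤b)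

    m∈D′ : + m ∈ D′
    m∈D′ = subst (_∈ D′) (trans (cong (λ z → + z ℤ.- + b) c≡b+m) (+[m+n]-+m b m))
                 (v₃-v₂∈diffs {suc n} ≤-refl)

    m+δ∈D′ : + (m + δ (suc n)) ∈ D′
    m+δ∈D′ = subst (_∈ D′) (trans (cong (λ z → + z ℤ.- + a) b≡) (+[m+n]-+m a _))
                   (v₂-v₁∈diffs {suc n} ≤-refl)

    m+t∈D′ : ∀ {t} → t ≤ δ (suc n) → + (m + t) ∈ D′
    m+t∈D′ {zero} _ = subst (λ z → + z ∈ D′) (sym (+-identityʳ m)) m∈D′
    m+t∈D′ {suc t} 1+t≤δ with m≤n⇒m<n∨m≡n 1+t≤δ
    ... | inj₁ 1+t<δ =
      diffs-mono (n≤1+n n) (m+t∈D z<s (≤-trans (<⇒≤ 1+t<δ) δ≤2′) a+[m+1+t]<b)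
      where
      a+[m+1+t]<b : a + (m + suc t) < b
      a+[m+1+t]<b = subst (a + (m + suc t) <_) (sym b≡) (+-monoʳ-< a (+-monoʳ-< m 1+t<δ))
    ... | inj₂ 1+t≡δ = subst (λ s → + (m + s) ∈ D′) (sym 1+t≡δ) m+δ∈D′

    diffs-covers′ : ∀ {y} → y ≤ m + δ (suc n) → + y ∈ D′
    diffs-covers′ {y} y≤m+δ with y <? m
    ... | yes y<m = diffs-mono (n≤1+n n) (Mex-covers D y<m)
    ... | no y≮m  =
      subst (λ z → + z ∈ D′) (m+[n∸m]≡n (≮⇒≥ y≮m)) (m+t∈D′ (m≤n+o⇒m∸n≤o y m y≤m+δ))

    shape-suc : Shape (suc n)
    shape-suc = record
      { δ≤2 = δ≤2′ ; v₂≡ = b≡ ; v₃≡ = c≡b+m ; diffs-covers = diffs-covers′ }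

  shape : ∀ n → Shape n
  shape = <-rec Shape step
    where
    step : ∀ n → (∀ {k} → k < n → Shape k) → Shape n
    step zero    _      = shape-zero
    step (suc n) shape< = Step.shape-suc n (λ k≤n → shape< (s≤s k≤n))

  v₁-2v₂+v₃≡-δ : ∀ n → + v₁ n ℤ.- + 2 ℤ.* + v₂ n ℤ.+ + v₃ n ≡ ℤ.- + δ n
  v₁-2v₂+v₃≡-δ n = begin
    + v₁ n ℤ.- + 2 ℤ.* + v₂ n ℤ.+ + v₃ n
      ≡⟨ cong₂ (λ p q → x ℤ.- + 2 ℤ.* p ℤ.+ q) +v₂≡ +v₃≡ ⟩
    x ℤ.- + 2 ℤ.* y ℤ.+ (y ℤ.+ μ)
      ≡⟨ x-2[x+μ+d]+[x+μ+d+μ]≡-d x μ d ⟩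
    ℤ.- d
      ∎
    where
    open ≡-Reasoning
    S : Shape n
    S = shape n
    x μ d y : ℤ
    x = + v₁ n
    μ = + M n
    d = + δ n
    y = x ℤ.+ (μ ℤ.+ d)
    +v₂≡ : + v₂ n ≡ y
    +v₂≡ = trans (cong +_ (v₂≡ S)) (trans (pos-+ (v₁ n) _) (cong (ℤ._+_ x) (pos-+ (M n) (δ n))))
    +v₃≡ : + v₃ n ≡ y ℤ.+ μ
    +v₃≡ = trans (cong +_ (v₃≡ S)) (trans (pos-+ (v₂ n) (M n)) (cong (ℤ._+ μ) +v₂≡))

open import Data.Integer using (+_; _+_; _-_; _*_; -[1+_])
open import Data.Nat using (ℕ)
open import Data.Sum using (_⊎_)
open import Relation.Binary.PropositionalEquality using (_≡_)

corollary5 : (n : ℕ) →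
    let e = (+ v₁ n) - (+ 2) * (+ v₂ n) + (+ v₃ n) in
    (e ≡ + 0) ⊎ (e ≡ -[1+ 0 ]) ⊎ (e ≡ -[1+ 1 ])
corollary5 n rewrite v₁-2v₂+v₃≡-δ n = neg-≤2 (Shape.δ≤2 (shape n))
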